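{- Fix an integer $d\ge 1$. Consider the following recursive procedure applied to a formula $\forall\mathbf{y}\,\exists\mathbf{x}\,\psi$ with $\psi$ in $d$-CNF and $k=|\mathbf{x}|$ existential variables. For each set $C$ of literals over $\mathbf{x}$, let $G^\psi_C$ be the set of clauses of $\psi$ whose set of literals over $\mathbf{x}$ is exactly $C$, and let $\mathcal{S}^\psi_C=\{c\setminus C : c\in G^\psi_C\}$ (the restrictions of these clauses to their universal literals). Let $X=2^d d\ln k$. For each $C$ with $\mathcal{S}^\psi_C\neq\{\emptyset\}$ (and nonempty), greedily build a family of clauses of $\mathcal{S}^\psi_C$ pairwise sharing no variable, adding clauses until none can be added or until the family has at least $X$ members. If for every such $C$ a family of at least $X$ members is found, the call is a leaf. Otherwise, for some such $C$ the greedy family is maximal with fewer than $X$ members; let $H$ be the set of (at most $dX$) universal variables occurring in its clauses, and recursively call the procedure on $\psi(\sigma)$ for every assignment $\sigma:H\to\{0,1\}$ (where $\psi(\sigma)$ removes falsified literals and satisfied clauses). Then the recursion tree of this procedure has at most $k^{O_d(k^{d-1})}$ leaves.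
   Context: $\mathbf{y}$ (universal) and $\mathbf{x}$ (existential) are tuples of Boolean variables; a $d$-CNF is a conjunction of clauses each with at most $d$ literals. It is assumed throughout that $\psi$ contains no clause consisting only of universal literals. The notation $O_d(\cdot)$ hides factors depending only on $d$. -}

module Defs where

open import Data.Nat using (ℕ; zero; suc; _+_; _*_; _^_; _≤_; _!)
open import Data.Bool using (Bool; true; false; _∧_; _∨_; not)
open import Data.Maybe using (Maybe; just; nothing)
open import Data.Product using (_×_; _,_; ∃-syntax)
open import Data.Fin using (Fin)
open import Data.Vec using (Vec; []; _∷_; lookup; tabulate)
open import Data.List using (List; []; _∷_; _++_; map; length)
open import Data.Bool.ListAction using (any)
open import Data.List.Relation.Unary.All using (All)
open import Data.List.Relation.Unary.Any using (Any)
open import Data.List.Relation.Unary.AllPairs using (AllPairs)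
open import Data.List.Membership.Propositional using (_∈_)
open import Data.Sum using (_⊎_)
open import Relation.Nullary using (¬_)
open import Relation.Binary.PropositionalEquality using (_≡_; _≢_)

-- Position i holds (p , q): p = "the positive literal v_i is present",
-- q = "the negative literal ¬v_i is present".  So a vector is exactly
-- a SET of literals over those m variables.

LitSet : ℕ → Set
LitSet m = Vec (Bool × Bool) m

litCount : ∀ {m} → LitSet m → ℕ
litCount [] = 0
litCount ((p , q) ∷ v) = b2n p + (b2n q + litCount v)
  where
  b2n : Bool → ℕ
  b2n true = 1
  b2n false = 0

usesᵇ : ∀ {m} → LitSet m → Fin m → Bool
usesᵇ v i with lookup v i
... | (p , q) = p ∨ q

Uses : ∀ {m} → LitSet m → Fin m → Set
Uses v i = usesᵇ v i ≡ true

Disjoint : ∀ {m} → LitSet m → LitSet m → Set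
Disjoint u v = ∀ i → ¬ (Uses u i × Uses v i)

-- Clauses over universal variables y = (y_0..y_{n-1}) and existential
-- variables x = (x_0..x_{k-1}); a clause is a set of literals, split into
-- its universal part and its existential part.

record Clause (n k : ℕ) : Set where
  constructor clause
  field
    upart : LitSet n
    xpart : LitSet k
open Clause public

Formula : ℕ → ℕ → Set
Formula n k = List (Clause n k)

width : ∀ {n k} → Clause n k → ℕ
width c = litCount (upart c) + litCount (xpart c)

IsDCNF : ∀ {n k} → ℕ → Formula n k → Set
IsDCNF d ψ = All (λ c → width c ≤ d) ψ

NoUnivClause : ∀ {n k} → Formula n k → Set
NoUnivClause ψ = All (λ c → ∃[ i ] Uses (xpart c) i) ψ

-- G^ψ_C and S^ψ_C.  u ∈ S^ψ_C  iff  some clause c of ψ has x-part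
-- exactly C and universal part u (= c \ C).

InS : ∀ {n k} → Formula n k → LitSet k → LitSet n → Set
InS ψ C u = Any (λ c → xpart c ≡ C × upart c ≡ u) ψ

-- S^ψ_C is nonempty and ≠ {∅}, i.e. contains a nonempty clause
Relevant : ∀ {n k} → Formula n k → LitSet k → Set
Relevant ψ C = ∃[ u ] (InS ψ C u × ∃[ i ] Uses u i)

DisjointFamily : ∀ {n k} → Formula n k → LitSet k → List (LitSet n) → Set
DisjointFamily ψ C F = AllPairs (λ u v → u ≢ v × Disjoint u v) F × All (InS ψ C) F

Maximal : ∀ {n k} → Formula n k → LitSet k → List (LitSet n) → Set
Maximal ψ C F = ∀ u → InS ψ C u → (u ∈ F) ⊎ Any (λ f → ¬ Disjoint u f) F

-- The threshold X = 2^d · d · ln k.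
-- expNum m N = N! · Σ_{j ≤ N} m^j / j!   (N! times a partial sum of e^m)
-- since expNum 0 N = 1, expNum (N+1) = (N+1)·expNum N + m^(N+1).

expNum : ℕ → ℕ → ℕ
expNum m zero = 1
expNum m (suc N) = suc N * expNum m N + m ^ suc N

-- AtLeastX d k m  ⇔  m ≥ 2^d·d·ln k  ⇔  e^m ≥ k^(2^d·d)
-- ⇔ some partial sum of the series of e^m is ≥ k^(2^d·d).
AtLeastX : ℕ → ℕ → ℕ → Set
AtLeastX d k m = ∃[ N ] (k ^ (2 ^ d * d) * (N !) ≤ expNum m N)

varsOf : ∀ {n} → List (LitSet n) → Vec Bool n
varsOf F = tabulate (λ i → any (λ f → usesᵇ f i) F)

PAssign : ℕ → Set
PAssign n = Vec (Maybe Bool) n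

assignmentsOn : ∀ {n} → Vec Bool n → List (PAssign n)
assignmentsOn [] = [] ∷ []
assignmentsOn (false ∷ H) = map (nothing ∷_) (assignmentsOn H)
assignmentsOn (true ∷ H) =
  map (just true ∷_) (assignmentsOn H) ++ map (just false ∷_) (assignmentsOn H)

satU : ∀ {n} → PAssign n → LitSet n → Bool
satU [] [] = false
satU (nothing ∷ σ) (_ ∷ u) = satU σ u
satU (just b ∷ σ) ((p , q) ∷ u) = (p ∧ b) ∨ ((q ∧ not b) ∨ satU σ u)

eraseU : ∀ {n} → PAssign n → LitSet n → LitSet n
eraseU [] [] = []
eraseU (nothing ∷ σ) (l ∷ u) = l ∷ eraseU σ u
eraseU (just b ∷ σ) (l ∷ u) = (false , false) ∷ eraseU σ u

restrict : ∀ {n k} → PAssign n → Formula n k → Formula n k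
restrict σ [] = []
restrict σ (c ∷ ψ) with satU σ (upart c)
... | true = restrict σ ψ
... | false = clause (eraseU σ (upart c)) (xpart c) ∷ restrict σ ψ

-- Executions of the (nondeterministic) recursive procedure.
-- Run d k ψ L : some execution on ψ has a recursion tree with L leaves.
-- Runs d k φs L : executions on each formula of the list, L leaves total.

mutual
  data Run (d k : ℕ) {n : ℕ} : Formula n k → ℕ → Set where
    leaf : ∀ {ψ} →
           (∀ C → Relevant ψ C →
              ∃[ F ] (DisjointFamily ψ C F × AtLeastX d k (length F))) →
           Run d k ψ 1
    branch : ∀ {ψ L} (C : LitSet k) (F : List (LitSet n)) →
             Relevant ψ C → DisjointFamily ψ C F → Maximal ψ C F →
             ¬ AtLeastX d k (length F) →
             Runs d k (map (λ σ → restrict σ ψ) (assignmentsOn (varsOf F))) L →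
             Run d k ψ L

  data Runs (d k : ℕ) {n : ℕ} : List (Formula n k) → ℕ → Set where
    [] : Runs d k [] 0
    _∷_ : ∀ {φ φs a b} → Run d k φ a → Runs d k φs b → Runs d k (φ ∷ φs) (a + b)

-- For a literal set C over x, let w_ψ(C) be the largest number of universal literals of a
-- clause in S^ψ_C, and take the potential Φ(ψ) = Σ_C w_ψ(C). Restriction never increases w.
-- At a branching on C, every clause of S^ψ_C is empty or, by maximality of the greedy family F,
-- meets H = vars(F); so in ψ(σ) it has lost a literal, and since C is relevant, w(C) drops.
-- Hence Φ decreases along every edge of the recursion tree. A node has 2^|H| ≤ 2^(d|F|)
-- children, and |F| < X = 2^d d ln k bounds this by k^(O_d(1)). For a d-CNF,
-- Φ(ψ) ≤ Σ_C (d − |C|) = O_d(k^(d−1)), so there are at most (k^(O_d(1)))^Φ = k^(O_d(k^(d−1))) leaves.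

module Submission where

open import Defs
open import Data.Nat
  using (ℕ; zero; suc; _+_; _*_; _^_; _≤_; _<_; _∸_; _⊔_; pred; z≤n; s≤s; _!; NonZero; >-nonZero)
open import Data.Nat.Properties
open import Data.Nat.DivMod using (_/_; _%_; m≡m%n+[m/n]*n; m%n<n; m/n*n≤m)
open import Data.Nat.ListAction using (sum)
open import Data.Bool using (Bool; true; false; _∨_)
open import Data.Bool.Properties using (∨-zeroʳ) renaming (_≟_ to _≟ᵇ_)
open import Data.Maybe using (just; nothing)
open import Data.Product using (_×_; _,_; ∃-syntax)
open import Data.Product.Properties using () renaming (≡-dec to ×-≡-dec)
open import Data.Sum using (_⊎_; inj₁; inj₂; [_,_]′)
open import Data.Fin using (Fin) renaming (zero to fzero; suc to fsuc)
open import Data.Fin.Properties using (any?)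
open import Data.Fin.Subset using (∣_∣)
open import Data.Vec using (Vec; []; _∷_; lookup; tabulate)
open import Data.Vec.Properties using (lookup∘tabulate) renaming (≡-dec to Vec-≡-dec)
open import Data.List using (List; []; _∷_; _++_; map; length)
open import Data.List.Properties using (length-map; length-++)
open import Data.List.Relation.Unary.All as All using (All; []; _∷_)
open import Data.List.Relation.Unary.All.Properties using (map⁺)
open import Data.List.Relation.Unary.Any using (here; there)
open import Data.List.Membership.Propositional using (_∈_; find)
open import Data.List.Membership.Propositional.Properties using (∈-map⁻; ∈-++⁻)
open import Data.Bool.ListAction using (any)
open import Function using (_∘_)
open import Relation.Nullary using (¬_; yes; no; contradiction)
open import Relation.Nullary.Decidable using (_×-dec_)
open import Relation.Binary.Definitions using (DecidableEquality)
open import Relation.Binary.PropositionalEquality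
open import Algebra.Properties.CommutativeSemigroup *-commutativeSemigroup using (interchange)

^-distribʳ-* : ∀ a b n → (a * b) ^ n ≡ a ^ n * b ^ n
^-distribʳ-* a b zero = refl
^-distribʳ-* a b (suc n) = begin
  a * b * (a * b) ^ n     ≡⟨ cong (a * b *_) (^-distribʳ-* a b n) ⟩
  a * b * (a ^ n * b ^ n) ≡⟨ interchange a b (a ^ n) (b ^ n) ⟩
  a * a ^ n * (b * b ^ n) ∎
  where open ≡-Reasoning

n!≤n^n : ∀ n → n ! ≤ n ^ n
n!≤n^n zero = ≤-refl
n!≤n^n (suc n) = *-monoʳ-≤ (suc n) (≤-trans (n!≤n^n n) (^-monoˡ-≤ n (n≤1+n n)))

m^n≤expNum : ∀ m n → m ^ n ≤ expNum m n
m^n≤expNum m zero = ≤-refl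
m^n≤expNum m (suc n) = m≤n+m (m ^ suc n) (suc n * expNum m n)

AtLeastX-one : ∀ d m → AtLeastX d 1 m
AtLeastX-one d m = 0 , ≤-reflexive (cong (_* 1) (^-zeroˡ (2 ^ d * d)))

-- m < X forces 2^⌊m/2⌋ < k^(2^d·d), as otherwise ⌊m/2⌋ witnesses AtLeastX.
¬AtLeastX⇒2^m≤ : ∀ {d k m} → 2 ≤ k → ¬ AtLeastX d k m → 2 ^ m ≤ k ^ (1 + 2 ^ d * d * 2)
¬AtLeastX⇒2^m≤ {d} {k} {m} 2≤k m<X = begin
  2 ^ m               ≤⟨ ^-monoʳ-≤ 2 m≤1+2N ⟩
  2 * 2 ^ (N * 2)     ≡⟨ cong (2 *_) (^-*-assoc 2 N 2) ⟨
  2 * (2 ^ N) ^ 2     ≤⟨ *-mono-≤ 2≤k (^-monoˡ-≤ 2 (<⇒≤ 2^N<K)) ⟩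
  k * (k ^ A) ^ 2     ≡⟨ cong (k *_) (^-*-assoc k A 2) ⟩
  k * k ^ (A * 2)     ∎
  where
  open ≤-Reasoning
  A = 2 ^ d * d
  N = m / 2
  m≤1+2N : m ≤ 1 + N * 2
  m≤1+2N = ≤-trans (≤-reflexive (m≡m%n+[m/n]*n m 2)) (+-monoˡ-≤ (N * 2) (≤-pred (m%n<n m 2)))
  witness : k ^ A ≤ 2 ^ N → AtLeastX d k m
  witness K≤2^N = N , (begin
    k ^ A * N !     ≤⟨ *-mono-≤ K≤2^N (n!≤n^n N) ⟩
    2 ^ N * N ^ N   ≡⟨ ^-distribʳ-* 2 N N ⟨
    (2 * N) ^ N     ≤⟨ ^-monoˡ-≤ N (≤-trans (≤-reflexive (*-comm 2 N)) (m/n*n≤m m 2)) ⟩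
    m ^ N           ≤⟨ m^n≤expNum m N ⟩
    expNum m N      ∎)
  2^N<K : 2 ^ N < k ^ A
  2^N<K = ≰⇒> (m<X ∘ witness)

sum-map-mono-≤ : ∀ {A : Set} {f g : A → ℕ} → (∀ x → f x ≤ g x) → (xs : List A) →
                 sum (map f xs) ≤ sum (map g xs)
sum-map-mono-≤ f≤g [] = z≤n
sum-map-mono-≤ f≤g (x ∷ xs) = +-mono-≤ (f≤g x) (sum-map-mono-≤ f≤g xs)

sum-map-mono-< : ∀ {A : Set} {f g : A → ℕ} {x xs} → (∀ y → f y ≤ g y) → x ∈ xs → f x < g x →
                 sum (map f xs) < sum (map g xs)
sum-map-mono-< {xs = _ ∷ xs} f≤g (here refl) fx<gx = +-mono-<-≤ fx<gx (sum-map-mono-≤ f≤g xs)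
sum-map-mono-< f≤g (there x∈xs) fx<gx = +-mono-≤-< (f≤g _) (sum-map-mono-< f≤g x∈xs fx<gx)

sum-map-≤-length-* : ∀ {A : Set} {f : A → ℕ} {b} {xs : List A} → All (λ x → f x ≤ b) xs →
                     sum (map f xs) ≤ length xs * b
sum-map-≤-length-* [] = z≤n
sum-map-≤-length-* (fx≤b ∷ fxs≤b) = +-mono-≤ fx≤b (sum-map-≤-length-* fxs≤b)

sumVecs : ∀ {A : Set} → List A → (k : ℕ) → (Vec A k → ℕ) → ℕ
sumVecs as zero f = f []
sumVecs as (suc k) f = sum (map (λ a → sumVecs as k (f ∘ (a ∷_))) as)

module _ {A : Set} (as : List A) where

  sumVecs-mono-≤ : ∀ k {f g : Vec A k → ℕ} → (∀ v → f v ≤ g v) → sumVecs as k f ≤ sumVecs as k g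
  sumVecs-mono-≤ zero f≤g = f≤g []
  sumVecs-mono-≤ (suc k) f≤g = sum-map-mono-≤ (λ a → sumVecs-mono-≤ k (f≤g ∘ (a ∷_))) as

  sumVecs-mono-< : (∀ a → a ∈ as) → ∀ k {f g : Vec A k → ℕ} → (∀ v → f v ≤ g v) →
                   ∀ v → f v < g v → sumVecs as k f < sumVecs as k g
  sumVecs-mono-< _ zero f≤g [] fv<gv = fv<gv
  sumVecs-mono-< ∈as (suc k) f≤g (a ∷ v) fv<gv =
    sum-map-mono-< (λ b → sumVecs-mono-≤ k (f≤g ∘ (b ∷_))) (∈as a)
      (sumVecs-mono-< ∈as k (f≤g ∘ (a ∷_)) v fv<gv)

  sumVecs-zero : ∀ k → sumVecs as k (λ _ → 0) ≡ 0
  sumVecs-zero zero = refl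
  sumVecs-zero (suc k) rewrite sumVecs-zero k = sum-zeros as
    where
    sum-zeros : (bs : List A) → sum (map (λ _ → 0) bs) ≡ 0
    sum-zeros [] = refl
    sum-zeros (_ ∷ bs) = sum-zeros bs

litCount-∷ : ∀ {m} (x : Bool × Bool) (v : LitSet m) → litCount (x ∷ v) ≡ litCount (x ∷ []) + litCount v
litCount-∷ (false , false) v = refl
litCount-∷ (false , true) v = refl
litCount-∷ (true , false) v = refl
litCount-∷ (true , true) v = refl

litCount≤litCount-∷ : ∀ {m} x (v : LitSet m) → litCount v ≤ litCount (x ∷ v)
litCount≤litCount-∷ x v rewrite litCount-∷ x v = m≤n+m (litCount v) _

litCount-∷-mono-≤ : ∀ {m} x (u v : LitSet m) → litCount u ≤ litCount v →
                    litCount (x ∷ u) ≤ litCount (x ∷ v)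
litCount-∷-mono-≤ x u v u≤v rewrite litCount-∷ x u | litCount-∷ x v = +-monoʳ-≤ _ u≤v

litCount-∷-mono-< : ∀ {m} x (u v : LitSet m) → litCount u < litCount v →
                    litCount (x ∷ u) < litCount (x ∷ v)
litCount-∷-mono-< x u v u<v rewrite litCount-∷ x u | litCount-∷ x v = +-monoʳ-< _ u<v

Uses⇒litCount>0 : ∀ {m} (u : LitSet m) {i} → Uses u i → 0 < litCount u
Uses⇒litCount>0 ((true , _) ∷ u) {fzero} _ = s≤s z≤n
Uses⇒litCount>0 ((false , true) ∷ u) {fzero} _ = s≤s z≤n
Uses⇒litCount>0 (x ∷ u) {fsuc i} used = <-≤-trans (Uses⇒litCount>0 u used) (litCount≤litCount-∷ x u)

litCount≡0⊎Uses : ∀ {m} (u : LitSet m) → litCount u ≡ 0 ⊎ ∃[ i ] Uses u i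
litCount≡0⊎Uses [] = inj₁ refl
litCount≡0⊎Uses ((true , _) ∷ u) = inj₂ (fzero , refl)
litCount≡0⊎Uses ((false , true) ∷ u) = inj₂ (fzero , refl)
litCount≡0⊎Uses ((false , false) ∷ u) with litCount≡0⊎Uses u
... | inj₁ empty = inj₁ empty
... | inj₂ (i , used) = inj₂ (fsuc i , used)

¬Disjoint⇒shared : ∀ {m} (u v : LitSet m) → ¬ Disjoint u v → ∃[ i ] (Uses u i × Uses v i)
¬Disjoint⇒shared u v ¬disjoint with any? (λ i → (usesᵇ u i ≟ᵇ true) ×-dec (usesᵇ v i ≟ᵇ true))
... | yes shared = shared
... | no ¬shared = contradiction (λ i uv → ¬shared (i , uv)) ¬disjoint

_≟ˡ_ : ∀ {m} → DecidableEquality (LitSet m)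
_≟ˡ_ = Vec-≡-dec (×-≡-dec _≟ᵇ_ _≟ᵇ_)

∣tabulate-∨∣≤ : ∀ {n} (g h : Fin n → Bool) →
               ∣ tabulate (λ i → g i ∨ h i) ∣ ≤ ∣ tabulate g ∣ + ∣ tabulate h ∣
∣tabulate-∨∣≤ {zero} g h = z≤n
∣tabulate-∨∣≤ {suc n} g h with g fzero | h fzero | ∣tabulate-∨∣≤ (g ∘ fsuc) (h ∘ fsuc)
... | false | false | IH = IH
... | false | true  | IH = ≤-trans (s≤s IH) (≤-reflexive (sym (+-suc _ _)))
... | true  | false | IH = s≤s IH
... | true  | true  | IH = s≤s (≤-trans IH (+-monoʳ-≤ _ (n≤1+n _)))

∣tabulate-usesᵇ∣≤litCount : ∀ {n} (u : LitSet n) → ∣ tabulate (usesᵇ u) ∣ ≤ litCount u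
∣tabulate-usesᵇ∣≤litCount [] = z≤n
∣tabulate-usesᵇ∣≤litCount ((false , false) ∷ u) = ∣tabulate-usesᵇ∣≤litCount u
∣tabulate-usesᵇ∣≤litCount ((false , true) ∷ u) = s≤s (∣tabulate-usesᵇ∣≤litCount u)
∣tabulate-usesᵇ∣≤litCount ((true , false) ∷ u) = s≤s (∣tabulate-usesᵇ∣≤litCount u)
∣tabulate-usesᵇ∣≤litCount ((true , true) ∷ u) = s≤s (m≤n⇒m≤1+n (∣tabulate-usesᵇ∣≤litCount u))

∣tabulate-false∣≡0 : ∀ n → ∣ tabulate {n = n} (λ _ → false) ∣ ≡ 0
∣tabulate-false∣≡0 zero = refl
∣tabulate-false∣≡0 (suc n) = ∣tabulate-false∣≡0 n

∣varsOf∣≤ : ∀ {n} (F : List (LitSet n)) → ∣ varsOf F ∣ ≤ sum (map litCount F)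
∣varsOf∣≤ {n} [] = ≤-reflexive (∣tabulate-false∣≡0 n)
∣varsOf∣≤ (f ∷ F) =
  ≤-trans (∣tabulate-∨∣≤ (usesᵇ f) _) (+-mono-≤ (∣tabulate-usesᵇ∣≤litCount f) (∣varsOf∣≤ F))

varsOf-∈ : ∀ {n} {F : List (LitSet n)} {f i} → f ∈ F → Uses f i → lookup (varsOf F) i ≡ true
varsOf-∈ {f = f} {i} f∈F used = trans (lookup∘tabulate _ i) (any-∈ f∈F)
  where
  any-∈ : ∀ {G} → f ∈ G → any (λ g → usesᵇ g i) G ≡ true
  any-∈ (here refl) rewrite used = refl
  any-∈ {g ∷ _} (there f∈G) rewrite any-∈ f∈G = ∨-zeroʳ (usesᵇ g i)

length-assignmentsOn : ∀ {n} (H : Vec Bool n) → length (assignmentsOn H) ≡ 2 ^ ∣ H ∣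
length-assignmentsOn [] = refl
length-assignmentsOn (false ∷ H) = trans (length-map _ (assignmentsOn H)) (length-assignmentsOn H)
length-assignmentsOn (true ∷ H) = begin
  length (map (just true ∷_) σs ++ map (just false ∷_) σs)
    ≡⟨ length-++ (map (just true ∷_) σs) ⟩
  length (map (just true ∷_) σs) + length (map (just false ∷_) σs)
    ≡⟨ cong₂ _+_ (length-map _ σs) (length-map _ σs) ⟩
  length σs + length σs
    ≡⟨ cong (λ l → l + l) (length-assignmentsOn H) ⟩
  2 ^ ∣ H ∣ + 2 ^ ∣ H ∣
    ≡⟨ cong (2 ^ ∣ H ∣ +_) (+-identityʳ _) ⟨
  2 * 2 ^ ∣ H ∣ ∎
  where
  open ≡-Reasoning
  σs = assignmentsOn H

assignmentsOn-defined : ∀ {n} (H : Vec Bool n) {σ} → σ ∈ assignmentsOn H →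
                        ∀ {i} → lookup H i ≡ true → ∃[ b ] lookup σ i ≡ just b
assignmentsOn-defined (false ∷ H) σ∈ {fsuc i} Hi with ∈-map⁻ _ σ∈
... | _ , τ∈ , refl = assignmentsOn-defined H τ∈ Hi
assignmentsOn-defined (true ∷ H) σ∈ {i} Hi =
  [ extend true ∘ ∈-map⁻ _ , extend false ∘ ∈-map⁻ _ ]′
    (∈-++⁻ (map (just true ∷_) (assignmentsOn H)) σ∈) i Hi
  where
  extend : ∀ {σ} b → ∃[ τ ] (τ ∈ assignmentsOn H × σ ≡ just b ∷ τ) →
           ∀ j → lookup (true ∷ H) j ≡ true → ∃[ b′ ] lookup σ j ≡ just b′
  extend b (_ , _ , refl) fzero _ = b , refl
  extend b (_ , τ∈ , refl) (fsuc j) Hj = assignmentsOn-defined H τ∈ Hj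

litCount-eraseU-≤ : ∀ {n} (σ : PAssign n) (u : LitSet n) → litCount (eraseU σ u) ≤ litCount u
litCount-eraseU-≤ [] [] = z≤n
litCount-eraseU-≤ (nothing ∷ σ) (x ∷ u) = litCount-∷-mono-≤ x (eraseU σ u) u (litCount-eraseU-≤ σ u)
litCount-eraseU-≤ (just _ ∷ σ) (x ∷ u) = ≤-trans (litCount-eraseU-≤ σ u) (litCount≤litCount-∷ x u)

litCount-eraseU-< : ∀ {n} (σ : PAssign n) (u : LitSet n) {i b} → lookup σ i ≡ just b → Uses u i →
                    litCount (eraseU σ u) < litCount u
litCount-eraseU-< (just _ ∷ σ) ((true , _) ∷ u) {fzero} _ _ =
  s≤s (≤-trans (litCount-eraseU-≤ σ u) (m≤n+m (litCount u) _))
litCount-eraseU-< (just _ ∷ σ) ((false , true) ∷ u) {fzero} _ _ = s≤s (litCount-eraseU-≤ σ u)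
litCount-eraseU-< (nothing ∷ σ) (x ∷ u) {fsuc i} σi used =
  litCount-∷-mono-< x (eraseU σ u) u (litCount-eraseU-< σ u σi used)
litCount-eraseU-< (just _ ∷ σ) (x ∷ u) {fsuc i} σi used =
  <-≤-trans (litCount-eraseU-< σ u σi used) (litCount≤litCount-∷ x u)

restrict-InS⁻ : ∀ {n k} (σ : PAssign n) (ψ : Formula n k) {C u′} → InS (restrict σ ψ) C u′ →
                ∃[ u ] (InS ψ C u × eraseU σ u ≡ u′)
restrict-InS⁻ σ (c ∷ ψ) p with satU σ (upart c)
... | true = let u , q , e = restrict-InS⁻ σ ψ p in u , there q , e
restrict-InS⁻ σ (c ∷ ψ) (here (refl , refl)) | false = upart c , here (refl , refl) , refl
restrict-InS⁻ σ (c ∷ ψ) (there p) | false = let u , q , e = restrict-InS⁻ σ ψ p in u , there q , e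

restrict-IsDCNF : ∀ {n k d} (σ : PAssign n) (ψ : Formula n k) → IsDCNF d ψ → IsDCNF d (restrict σ ψ)
restrict-IsDCNF σ [] [] = []
restrict-IsDCNF σ (c ∷ ψ) (c≤d ∷ ψ≤d) with satU σ (upart c)
... | true = restrict-IsDCNF σ ψ ψ≤d
... | false = ≤-trans (+-monoˡ-≤ _ (litCount-eraseU-≤ σ (upart c))) c≤d ∷ restrict-IsDCNF σ ψ ψ≤d

-- Universal width and the potential

univWidth : ∀ {n k} → Formula n k → LitSet k → ℕ
univWidth [] C = 0
univWidth (c ∷ ψ) C with xpart c ≟ˡ C
... | yes _ = litCount (upart c) ⊔ univWidth ψ C
... | no _ = univWidth ψ C

module _ {n k : ℕ} where

  univWidth-≥ : ∀ {ψ : Formula n k} {C u} → InS ψ C u → litCount u ≤ univWidth ψ C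
  univWidth-≥ {c ∷ ψ} (here (refl , refl)) with xpart c ≟ˡ xpart c
  ... | yes _ = m≤m⊔n _ _
  ... | no ≢C = contradiction refl ≢C
  univWidth-≥ {c ∷ ψ} {C} (there p) with xpart c ≟ˡ C
  ... | yes _ = ≤-trans (univWidth-≥ p) (m≤n⊔m _ _)
  ... | no _ = univWidth-≥ p

  univWidth-≤ : ∀ {ψ : Formula n k} {C b} → (∀ {u} → InS ψ C u → litCount u ≤ b) →
                univWidth ψ C ≤ b
  univWidth-≤ {[]} _ = z≤n
  univWidth-≤ {c ∷ ψ} {C} S≤b with xpart c ≟ˡ C
  ... | yes refl = ⊔-lub (S≤b (here (refl , refl))) (univWidth-≤ (S≤b ∘ there))
  ... | no _ = univWidth-≤ (S≤b ∘ there)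

  univWidth-< : ∀ {ψ : Formula n k} {C b} → 0 < b → (∀ {u} → InS ψ C u → litCount u < b) →
                univWidth ψ C < b
  univWidth-< {b = suc _} _ S<b = s≤s (univWidth-≤ (≤-pred ∘ S<b))

  Relevant⇒univWidth>0 : ∀ {ψ : Formula n k} {C} → Relevant ψ C → 0 < univWidth ψ C
  Relevant⇒univWidth>0 (u , p , _ , used) = <-≤-trans (Uses⇒litCount>0 u used) (univWidth-≥ p)

  InS⇒litCount+litCount≤ : ∀ {d} {ψ : Formula n k} {C u} → IsDCNF d ψ → InS ψ C u →
                           litCount u + litCount C ≤ d
  InS⇒litCount+litCount≤ ψ≤d p with find p
  ... | c , c∈ψ , refl , refl = All.lookup ψ≤d c∈ψ

  univWidth-restrict-≤ : ∀ (σ : PAssign n) (ψ : Formula n k) C →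
                         univWidth (restrict σ ψ) C ≤ univWidth ψ C
  univWidth-restrict-≤ σ ψ C = univWidth-≤ shrinks
    where
    shrinks : ∀ {u′} → InS (restrict σ ψ) C u′ → litCount u′ ≤ univWidth ψ C
    shrinks p with restrict-InS⁻ σ ψ p
    ... | u , q , refl = ≤-trans (litCount-eraseU-≤ σ u) (univWidth-≥ q)

litPairs : List (Bool × Bool)
litPairs = (false , false) ∷ (true , false) ∷ (false , true) ∷ (true , true) ∷ []

∈-litPairs : ∀ x → x ∈ litPairs
∈-litPairs (false , false) = here refl
∈-litPairs (true , false) = there (here refl)
∈-litPairs (false , true) = there (there (here refl))
∈-litPairs (true , true) = there (there (there (here refl)))

potential : ∀ {n k} → Formula n k → ℕ
potential {k = k} ψ = sumVecs litPairs k (univWidth ψ)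

capacity : ℕ → ℕ → ℕ
capacity k d = sumVecs litPairs k (λ C → d ∸ litCount C)

potential≤capacity : ∀ {n k d} {ψ : Formula n k} → IsDCNF d ψ → potential ψ ≤ capacity k d
potential≤capacity {k = k} ψ≤d =
  sumVecs-mono-≤ litPairs k (λ C → univWidth-≤ (m+n≤o⇒m≤o∸n _ ∘ InS⇒litCount+litCount≤ ψ≤d))

Relevant⇒potential>0 : ∀ {n k} {ψ : Formula n k} {C} → Relevant ψ C → 0 < potential ψ
Relevant⇒potential>0 {k = k} {C = C} rel =
  ≤-<-trans z≤n (sumVecs-mono-< litPairs ∈-litPairs k (λ _ → z≤n) C (Relevant⇒univWidth>0 rel))

Maximal⇒meets-varsOf : ∀ {n k} {ψ : Formula n k} {C F u i} → Maximal ψ C F → InS ψ C u → Uses u i →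
                       ∃[ j ] (Uses u j × lookup (varsOf F) j ≡ true)
Maximal⇒meets-varsOf {u = u} max p used with max u p
... | inj₁ u∈F = _ , used , varsOf-∈ u∈F used
... | inj₂ meets with find meets
...   | f , f∈F , ¬disjoint with ¬Disjoint⇒shared u f ¬disjoint
...     | j , uj , fj = j , uj , varsOf-∈ f∈F fj

univWidth-restrict-< : ∀ {n k} {ψ : Formula n k} {C F σ} → Relevant ψ C → Maximal ψ C F →
                       σ ∈ assignmentsOn (varsOf F) → univWidth (restrict σ ψ) C < univWidth ψ C
univWidth-restrict-< {ψ = ψ} {C} {F} {σ} rel max σ∈ = univWidth-< (Relevant⇒univWidth>0 rel) shrinks
  where
  shrinks : ∀ {u′} → InS (restrict σ ψ) C u′ → litCount u′ < univWidth ψ C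
  shrinks p with restrict-InS⁻ σ ψ p
  ... | u , q , refl with litCount≡0⊎Uses u
  ...   | inj₁ empty =
    ≤-<-trans (≤-trans (litCount-eraseU-≤ σ u) (≤-reflexive empty)) (Relevant⇒univWidth>0 rel)
  ...   | inj₂ (i , used) with Maximal⇒meets-varsOf max q used
  ...     | j , uj , Hj with assignmentsOn-defined (varsOf F) σ∈ Hj
  ...       | _ , σj = <-≤-trans (litCount-eraseU-< σ u σj uj) (univWidth-≥ q)

potential-restrict-< : ∀ {n k} {ψ : Formula n k} {C F σ} → Relevant ψ C → Maximal ψ C F →
                       σ ∈ assignmentsOn (varsOf F) → potential (restrict σ ψ) < potential ψ
potential-restrict-< {k = k} {ψ} {C} {σ = σ} rel max σ∈ =
  sumVecs-mono-< litPairs ∈-litPairs k (univWidth-restrict-≤ σ ψ) C (univWidth-restrict-< rel max σ∈)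

-- Counting leaves

capacity-zero : ∀ k → capacity k 0 ≡ 0
capacity-zero k = n≤0⇒n≡0 (≤-trans (sumVecs-mono-≤ litPairs k (λ C → ≤-reflexive (0∸n≡0 (litCount C))))
                                   (≤-reflexive (sumVecs-zero litPairs k)))

capacity-mono : ∀ k j → capacity k j ≤ capacity k (suc j)
capacity-mono k j = sumVecs-mono-≤ litPairs k (λ C → ∸-monoˡ-≤ (litCount C) (n≤1+n j))

^-suc+^≤suc^-suc : ∀ a j → a ^ suc j + a ^ j ≤ suc a ^ suc j
^-suc+^≤suc^-suc a j = begin
  a * a ^ j + a ^ j         ≡⟨ +-comm (a * a ^ j) (a ^ j) ⟩
  a ^ j + a * a ^ j         ≤⟨ +-mono-≤ a^j≤ (*-monoʳ-≤ a a^j≤) ⟩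
  suc a ^ j + a * suc a ^ j ∎
  where
  open ≤-Reasoning
  a^j≤ = ^-monoˡ-≤ j (n≤1+n a)

capacity≤ : ∀ k j → capacity k (suc j) ≤ 4 ^ suc j * suc k ^ j
capacity≤ zero j = begin
  suc j           ≤⟨ n≤4^n (suc j) ⟩
  4 ^ suc j       ≡⟨ *-identityʳ (4 ^ suc j) ⟨
  4 ^ suc j * 1   ≡⟨ cong (4 ^ suc j *_) (^-zeroˡ j) ⟨
  4 ^ suc j * 1 ^ j ∎
  where
  open ≤-Reasoning
  n≤4^n : ∀ n → n ≤ 4 ^ n
  n≤4^n zero = z≤n
  n≤4^n (suc n) =
    ≤-trans (s≤s (n≤4^n n)) (≤-trans (+-monoˡ-≤ (4 ^ n) (m^n>0 4 n)) (+-monoʳ-≤ (4 ^ n) (m≤m+n (4 ^ n) _)))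
capacity≤ (suc k) zero rewrite capacity-zero k | sumVecs-zero litPairs k =
  ≤-trans (≤-reflexive (+-identityʳ _)) (capacity≤ k zero)
capacity≤ (suc k) (suc j) = begin
  capacity k (2 + j) + (capacity k (1 + j) + (capacity k (1 + j) + (capacity k j + 0)))
    ≤⟨ +-mono-≤ (capacity≤ k (suc j)) (+-mono-≤ IH (+-mono-≤ IH last≤X)) ⟩
  T * a ^ suc j + (X + (X + X))
    ≤⟨ +-monoʳ-≤ (T * a ^ suc j) (+-monoʳ-≤ X (+-monoʳ-≤ X (m≤m+n X _))) ⟩
  T * a ^ suc j + 4 * X
    ≡⟨ cong (T * a ^ suc j +_) (*-assoc 4 (4 ^ suc j) (a ^ j)) ⟨
  T * a ^ suc j + T * a ^ j
    ≡⟨ *-distribˡ-+ T (a ^ suc j) (a ^ j) ⟨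
  T * (a ^ suc j + a ^ j)
    ≤⟨ *-monoʳ-≤ T (^-suc+^≤suc^-suc a j) ⟩
  T * suc a ^ suc j ∎
  where
  open ≤-Reasoning
  a = suc k
  T = 4 ^ (2 + j)
  X = 4 ^ suc j * a ^ j
  IH = capacity≤ k j
  last≤X : capacity k j + 0 ≤ X
  last≤X = ≤-trans (≤-reflexive (+-identityʳ _)) (≤-trans (capacity-mono k j) IH)

potential≤c*k^[d∸1] : ∀ {n k j} {ψ : Formula n k} → 1 ≤ k → IsDCNF (suc j) ψ →
                       potential ψ ≤ 4 ^ suc j * 2 ^ j * k ^ j
potential≤c*k^[d∸1] {k = k} {j} {ψ} 1≤k ψ≤d = begin
  potential ψ                 ≤⟨ potential≤capacity ψ≤d ⟩
  capacity k (suc j)          ≤⟨ capacity≤ k j ⟩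
  4 ^ suc j * suc k ^ j       ≤⟨ *-monoʳ-≤ (4 ^ suc j) (^-monoˡ-≤ j 1+k≤2k) ⟩
  4 ^ suc j * (2 * k) ^ j     ≡⟨ cong (4 ^ suc j *_) (^-distribʳ-* 2 k j) ⟩
  4 ^ suc j * (2 ^ j * k ^ j) ≡⟨ *-assoc (4 ^ suc j) (2 ^ j) (k ^ j) ⟨
  4 ^ suc j * 2 ^ j * k ^ j   ∎
  where
  open ≤-Reasoning
  1+k≤2k : suc k ≤ 2 * k
  1+k≤2k = ≤-trans (+-monoˡ-≤ k 1≤k) (≤-reflexive (cong (k +_) (sym (+-identityʳ k))))

branchExp : ℕ → ℕ
branchExp d = (1 + 2 ^ d * d * 2) * d

length-assignmentsOn-varsOf≤ : ∀ {n d k} .{{_ : NonZero k}} {F : List (LitSet n)} →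
                               All (λ f → litCount f ≤ d) F → ¬ AtLeastX d k (length F) →
                               length (assignmentsOn (varsOf F)) ≤ k ^ branchExp d
length-assignmentsOn-varsOf≤ {d = d} {k = 1} {F} _ F<X = contradiction (AtLeastX-one d (length F)) F<X
length-assignmentsOn-varsOf≤ {d = d} {k = k@(suc (suc _))} {F} F≤d F<X = begin
  length (assignmentsOn (varsOf F)) ≡⟨ length-assignmentsOn (varsOf F) ⟩
  2 ^ ∣ varsOf F ∣                  ≤⟨ ^-monoʳ-≤ 2 (≤-trans (∣varsOf∣≤ F) (sum-map-≤-length-* F≤d)) ⟩
  2 ^ (length F * d)                ≡⟨ ^-*-assoc 2 (length F) d ⟨
  (2 ^ length F) ^ d                ≤⟨ ^-monoˡ-≤ d (¬AtLeastX⇒2^m≤ {d} {k} (s≤s (s≤s z≤n)) F<X) ⟩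
  (k ^ (1 + 2 ^ d * d * 2)) ^ d     ≡⟨ ^-*-assoc k (1 + 2 ^ d * d * 2) d ⟩
  k ^ branchExp d                   ∎
  where open ≤-Reasoning

module _ {d k : ℕ} .{{_ : NonZero k}} where

  private
    B : ℕ
    B = k ^ branchExp d

    instance
      B≢0 : NonZero B
      B≢0 = m^n≢0 k (branchExp d)

  mutual
    leaves≤ : ∀ {n} {ψ : Formula n k} {L} → IsDCNF d ψ → Run d k ψ L → L ≤ B ^ potential ψ
    leaves≤ {ψ = ψ} _ (leaf _) = m^n>0 B (potential ψ)
    leaves≤ {ψ = ψ} {L} ψ≤d (branch C F rel (_ , F⊆S) max F<X runs) = begin
      L                                        ≤⟨ leavesAll≤ (pred Φ) children runs ⟩
      length (map (λ σ → restrict σ ψ) σs) * B ^ pred Φ ≡⟨ cong (_* B ^ pred Φ) (length-map _ σs) ⟩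
      length σs * B ^ pred Φ                   ≤⟨ *-monoˡ-≤ (B ^ pred Φ) (length-assignmentsOn-varsOf≤ F≤d F<X) ⟩
      B * B ^ pred Φ                           ≡⟨ cong (B ^_) (suc-pred Φ {{Φ≢0}}) ⟩
      B ^ Φ                                    ∎
      where
      open ≤-Reasoning
      Φ = potential ψ
      Φ≢0 : NonZero Φ
      Φ≢0 = >-nonZero (Relevant⇒potential>0 rel)
      σs = assignmentsOn (varsOf F)
      F≤d : All (λ f → litCount f ≤ d) F
      F≤d = All.map (λ p → m+n≤o⇒m≤o _ (InS⇒litCount+litCount≤ ψ≤d p)) F⊆S
      children : All (λ φ → IsDCNF d φ × potential φ ≤ pred Φ) (map (λ σ → restrict σ ψ) σs)
      children = map⁺ (All.tabulate (λ {σ} σ∈ →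
        restrict-IsDCNF σ ψ ψ≤d , <⇒≤pred (potential-restrict-< rel max σ∈)))

    leavesAll≤ : ∀ {n} {φs : List (Formula n k)} {L} M →
                 All (λ φ → IsDCNF d φ × potential φ ≤ M) φs → Runs d k φs L → L ≤ length φs * B ^ M
    leavesAll≤ M [] [] = z≤n
    leavesAll≤ M ((φ≤d , Φ≤M) ∷ φs) (run ∷ runs) =
      +-mono-≤ (≤-trans (leaves≤ φ≤d run) (^-monoʳ-≤ B Φ≤M)) (leavesAll≤ M φs runs)

lemma5 : (d : ℕ) → 1 ≤ d →
    ∃[ c ] ((n k : ℕ) (ψ : Formula n k) → 1 ≤ k → IsDCNF d ψ → NoUnivClause ψ →
      (L : ℕ) → Run d k ψ L → L ≤ k ^ (c * k ^ (d ∸ 1)))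
lemma5 d@(suc j) _ = branchExp d * (4 ^ d * 2 ^ j) , bound
  where
  bound : (n k : ℕ) (ψ : Formula n k) → 1 ≤ k → IsDCNF d ψ → NoUnivClause ψ →
          (L : ℕ) → Run d k ψ L → L ≤ k ^ (branchExp d * (4 ^ d * 2 ^ j) * k ^ j)
  bound n k@(suc _) ψ 1≤k ψ≤d _ L run = begin
    L                                           ≤⟨ leaves≤ ψ≤d run ⟩
    (k ^ branchExp d) ^ potential ψ             ≡⟨ ^-*-assoc k (branchExp d) (potential ψ) ⟩
    k ^ (branchExp d * potential ψ)             ≤⟨ ^-monoʳ-≤ k (*-monoʳ-≤ (branchExp d) (potential≤c*k^[d∸1] 1≤k ψ≤d)) ⟩
    k ^ (branchExp d * (4 ^ d * 2 ^ j * k ^ j)) ≡⟨ cong (k ^_) (*-assoc (branchExp d) (4 ^ d * 2 ^ j) (k ^ j)) ⟨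
    k ^ (branchExp d * (4 ^ d * 2 ^ j) * k ^ j) ∎
    where open ≤-Reasoning
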